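{- Let $b\ge 1$ and consider the Strings-and-Coins game on the complete bipartite graph $K(2,b)$ (equivalently $K(b,2)$). Under optimal play, Player 1 wins if $b$ is odd and Player 2 wins if $b$ is even.
   Context: Strings-and-Coins game: played on a finite graph in which every vertex initially has at least one incident edge. Two players, Player 1 moving first, alternately remove one edge. Whenever a removal leaves one or more vertices with no incident edges, the mover earns one point for each such vertex and must move again, provided edges remain. The game ends when no edges remain; a player wins if they have more points. Optimal play means each player maximizes (own final score) minus (opponent's final score). $K(a,b)$ denotes the complete bipartite graph with parts of sizes $a$ and $b$. -}

module Defs where

open import Data.Nat using (ℕ; zero; suc; _+_; _*_)
open import Data.Integer using (ℤ; _⊔_; -_) renaming (_+_ to _+ℤ_; +_ to ⁺_)
open import Data.Fin using (Fin; _↑ˡ_; _↑ʳ_; remQuot)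
open import Data.Fin.Properties using (_≟_)
open import Data.Bool using (Bool; true; false; if_then_else_; _∧_; not)
open import Data.List using (List; []; _∷_; map; filter; foldr; length)
open import Data.List.Base using (allFin)
open import Data.Product using (_×_; _,_; proj₁; proj₂)
open import Relation.Nullary.Decidable using (⌊_⌋; does)

record Graph : Set where
  field
    nV : ℕ
    nE : ℕ
    ends : Fin nE → Fin nV × Fin nV
open Graph public

-- A game position: the set of remaining edges (characteristic function).
Position : Graph → Set
Position G = Fin (nE G) → Bool

remove : (G : Graph) → Position G → Fin (nE G) → Position G
remove G S e f = if does (f ≟ e) then false else S f

touches : (G : Graph) → Fin (nE G) → Fin (nV G) → Bool
touches G f v = does (proj₁ (ends G f) ≟ v) Data.Bool.∨ does (proj₂ (ends G f) ≟ v)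

hasEdge : (G : Graph) → Position G → Fin (nV G) → Bool
hasEdge G S v = foldr Data.Bool._∨_ false (map (λ f → S f ∧ touches G f v) (allFin (nE G)))

points : (G : Graph) → Position G → Fin (nE G) → ℕ
points G S e = length (filter (λ v → Data.Bool._≟_ (hasEdge G S v ∧ not (hasEdge G (remove G S e) v)) true) (allFin (nV G)))

-- maximum of a list of integers (0 for the empty list; used only when nonempty)
best : List ℤ → ℤ
best [] = ⁺ 0
best (x ∷ xs) = foldr _⊔_ x xs

-- value G k S : optimal (mover's final score − opponent's final score)
-- counted from position S with the player to move, where k bounds the
-- number of remaining moves (k ≥ number of edges in S).
-- If the mover scores p > 0 points, they move again (value added);
-- otherwise the turn passes (value negated).
value : (G : Graph) → ℕ → Position G → ℤ
value G zero S = ⁺ 0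
value G (suc k) S =
  best (map option (filter (λ e → Data.Bool._≟_ (S e) true) (allFin (nE G))))
  where
    option : Fin (nE G) → ℤ
    option e with points G S e
    ... | zero  = - value G k (remove G S e)
    ... | suc p = (⁺ suc p) +ℤ value G k (remove G S e)

gameValue : Graph → ℤ
gameValue G = value G (nE G) (λ _ → true)

-- Complete bipartite graph K(a,b): vertices Fin (a + b) (first a form one part),
-- edges Fin (a * b), edge (i , j) joins i and a + j.
K : ℕ → ℕ → Graph
K a b = record
  { nV = a + b
  ; nE = a * b
  ; ends = λ e → let ij = remQuot {a} b e in (proj₁ ij ↑ˡ b , a ↑ʳ proj₂ ij)
  }

{-# OPTIONS --safe #-}
module Submission where

-- Write u, v for the part of size two and w₁ … w_b for the other part.  Up to
-- value, a position only depends on how many w are joined to both u and v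
-- ("full"), and how many hang from u alone or from v alone ("pendant").  Its
-- value is Φ f x y below: without full vertices the mover takes every edge;
-- otherwise the mover first collects the x + y pendant edges, each of which
-- scores, and then has to open a position of full vertices only, whose value
-- alternates between 3 and −4 with the parity of their number.  Φ satisfies
-- the one-step optimality equation of the game (no move does better and some
-- move attains it), so it is the value, by induction on the number of edges.
-- The initial position has b full vertices and no pendant ones.

open import Defs
open import Data.Bool using (Bool; true; false; not; _∧_; _∨_; if_then_else_)
import Data.Bool as Bool
open import Data.Bool.Properties
  using (∧-comm; ∨-comm; ∧-identityʳ; ∧-zeroʳ; ∧-inverseʳ; ¬-not; not-¬)
open import Data.Fin using (Fin; zero; suc; _↑ˡ_; _↑ʳ_; combine; remQuot)
open import Data.Fin.Properties
  using (_≟_; any?; suc-injective; remQuot-combine; combine-remQuot; combine-injectiveˡ; combine-injectiveʳ)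
open import Data.Integer as ℤ using (ℤ; +_; -_; -[1+_]; _<_; _⊔_; +<+; -<+)
import Data.Integer.Properties as ℤ
open import Data.Integer.Tactic.RingSolver using (solve-∀)
open import Data.List using (List; _∷_; map; filter; length; tabulate; allFin)
open import Data.Bool.ListAction using (or)
open import Data.List.Properties
  using (map-cong; map-tabulate; foldr-preservesᵇ; foldr-preservesᵒ; filter-none)
open import Data.List.Membership.Propositional using (_∈_)
open import Data.List.Membership.Propositional.Properties
  using (∈-map⁺; ∈-filter⁺; ∈-filter⁻; ∈-allFin)
open import Data.List.Relation.Unary.All as All using (All; _∷_)
open import Data.List.Relation.Unary.All.Properties using (map⁺; tabulate⁺)
open import Data.List.Relation.Unary.Any as Any using (Any; here; there)
open import Data.Nat as ℕ using (ℕ; zero; suc; _+_; _*_; _≤_; _%_; _<ᵇ_; z≤n; s≤s)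
import Data.Nat.Properties as ℕ
open import Data.Product using (∃; _×_; _,_; proj₁; proj₂; uncurry)
open import Data.Sum using (_⊎_; inj₁; inj₂)
open import Function using (_∘_; id)
open import Relation.Nullary using (yes; no)
open import Relation.Nullary.Decidable using (does; dec-true; dec-false)
open import Relation.Binary.PropositionalEquality
  using (_≡_; _≢_; _≗_; refl; sym; trans; cong; cong₂; subst; subst₂; module ≡-Reasoning)

[_] : Bool → ℕ
[ true ]  = 1
[ false ] = 0

count : ∀ {n} → (Fin n → Bool) → ℕ
count {zero}  P = 0
count {suc n} P = [ P zero ] + count (P ∘ suc)

count-cong : ∀ {n} {P Q : Fin n → Bool} → P ≗ Q → count P ≡ count Q
count-cong {zero}  P≗Q = refl
count-cong {suc n} P≗Q = cong₂ _+_ (cong [_] (P≗Q zero)) (count-cong (P≗Q ∘ suc))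

count-none : ∀ {n} {P : Fin n → Bool} → (∀ i → P i ≡ false) → count P ≡ 0
count-none {zero}  none = refl
count-none {suc n} none = cong₂ _+_ (cong [_] (none zero)) (count-none (none ∘ suc))

count-all : ∀ n → count {n} (λ _ → true) ≡ n
count-all zero    = refl
count-all (suc n) = cong suc (count-all n)

[]≡0 : ∀ {x} → [ x ] ≡ 0 → x ≡ false
[]≡0 {false} refl = refl

count≡0 : ∀ {n} {P : Fin n → Bool} → count P ≡ 0 → ∀ i → P i ≡ false
count≡0 {suc n} {P} P≡0 zero    = []≡0 (ℕ.m+n≡0⇒m≡0 [ P zero ] P≡0)
count≡0 {suc n} {P} P≡0 (suc i) = count≡0 (ℕ.m+n≡0⇒n≡0 [ P zero ] P≡0) i

count-↑ : ∀ m {n} (P : Fin (m + n) → Bool) →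
          count P ≡ count (P ∘ (_↑ˡ n)) + count (P ∘ (m ↑ʳ_))
count-↑ zero    P = refl
count-↑ (suc m) P =
  trans (cong (_+_ [ P zero ]) (count-↑ m (P ∘ suc))) (sym (ℕ.+-assoc [ P zero ] _ _))

count-split : ∀ {n} (P Q : Fin n → Bool) →
              count P ≡ count (λ i → P i ∧ Q i) + count (λ i → P i ∧ not (Q i))
count-split {zero}  P Q = refl
count-split {suc n} P Q with P zero | Q zero
... | false | _     = count-split (P ∘ suc) (Q ∘ suc)
... | true  | true  = cong suc (count-split (P ∘ suc) (Q ∘ suc))
... | true  | false = trans (cong suc (count-split (P ∘ suc) (Q ∘ suc))) (sym (ℕ.+-suc _ _))

count-single : ∀ {n} {P : Fin n → Bool} j → (∀ i → i ≢ j → P i ≡ false) → count P ≡ [ P j ]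
count-single {suc n} {P} zero    off =
  trans (cong (_+_ [ P zero ]) (count-none λ i → off (suc i) λ ())) (ℕ.+-identityʳ _)
count-single {suc n} {P} (suc j) off =
  cong₂ _+_ (cong [_] (off zero λ ()))
            (count-single j λ i i≢j → off (suc i) (i≢j ∘ suc-injective))

count-∧-≟ : ∀ {n} (P : Fin n → Bool) j → count (λ i → P i ∧ does (i ≟ j)) ≡ [ P j ]
count-∧-≟ P j = trans (count-single j off) (cong [_] at)
  where
  off : ∀ i → i ≢ j → P i ∧ does (i ≟ j) ≡ false
  off i i≢j = trans (cong (P i ∧_) (dec-false (i ≟ j) i≢j)) (∧-zeroʳ (P i))
  at : P j ∧ does (j ≟ j) ≡ P j
  at = trans (cong (P j ∧_) (dec-true (j ≟ j) refl)) (∧-identityʳ (P j))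

count-≡-off : ∀ {n} {P Q : Fin n → Bool} j → (∀ i → i ≢ j → P i ≡ Q i) →
              P j ≡ Q j → count P ≡ count Q
count-≡-off {P = P} {Q} j off at = count-cong agree
  where
  agree : P ≗ Q
  agree i with i ≟ j
  ... | yes refl = at
  ... | no i≢j   = off i i≢j

count-suc-off : ∀ {n} {P Q : Fin n → Bool} j → (∀ i → i ≢ j → P i ≡ Q i) →
                P j ≡ true → Q j ≡ false → count P ≡ suc (count Q)
count-suc-off {suc n} {P} {Q} zero off Pj Qj rewrite Pj | Qj =
  cong suc (count-cong λ i → off (suc i) λ ())
count-suc-off {suc n} {P} {Q} (suc j) off Pj Qj rewrite off zero (λ ()) =
  trans (cong (_+_ [ Q zero ]) (count-suc-off j (λ i i≢j → off (suc i) (i≢j ∘ suc-injective)) Pj Qj))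
        (ℕ.+-suc [ Q zero ] _)

true-or-none : ∀ {n} (P : Fin n → Bool) → (∃ λ i → P i ≡ true) ⊎ (∀ i → P i ≡ false)
true-or-none P with any? (λ i → P i Bool.≟ true)
... | yes found = inj₁ found
... | no ∄      = inj₂ λ i → ¬-not λ Pi → ∄ (i , Pi)

∧-not-true : ∀ x y → x ∧ not y ≡ true → x ≡ true × y ≡ false
∧-not-true true false refl = refl , refl

∧-not-false : ∀ {x} y → x ≡ true → x ∧ not y ≡ false → y ≡ true
∧-not-false true  refl refl = refl

or-tabulate : ∀ {n} (P : Fin n → Bool) → or (tabulate P) ≡ (0 <ᵇ count P)
or-tabulate {zero}  P = refl
or-tabulate {suc n} P with P zero
... | true  = refl
... | false = or-tabulate (P ∘ suc)

or-allFin : ∀ {n} (P : Fin n → Bool) → or (map P (allFin n)) ≡ (0 <ᵇ count P)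
or-allFin P = trans (cong or (map-tabulate id P)) (or-tabulate P)

length-filter-tabulate : ∀ {A : Set} {n} (X : A → Bool) (g : Fin n → A) →
                         length (filter (λ a → X a Bool.≟ true) (tabulate g)) ≡ count (X ∘ g)
length-filter-tabulate {n = zero}  X g = refl
length-filter-tabulate {n = suc n} X g with X (g zero)
... | true  = cong suc (length-filter-tabulate X (g ∘ suc))
... | false = length-filter-tabulate X (g ∘ suc)

0<ᵇ[]+[] : ∀ x y → (0 <ᵇ [ x ] + [ y ]) ≡ x ∨ y
0<ᵇ[]+[] true  y     = refl
0<ᵇ[]+[] false true  = refl
0<ᵇ[]+[] false false = refl

-- The game on an arbitrary graph

turnValue : ℕ → ℤ → ℤ
turnValue zero    v = - v
turnValue (suc p) v = + suc p ℤ.+ v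

liveEdges : (G : Graph) → Position G → List (Fin (nE G))
liveEdges G S = filter (λ e → S e Bool.≟ true) (allFin (nE G))

moveValue : (G : Graph) → ℕ → Position G → Fin (nE G) → ℤ
moveValue G k S e = turnValue (points G S e) (value G k (remove G S e))

-- The move evaluation inside 'value' is a local function; it is named here
-- through an existential so that it can be compared with moveValue.
value-suc : ∀ G k S → value G (suc k) S ≡ best (map (moveValue G k S) (liveEdges G S))
value-suc G k S =
  trans (proj₂ unfolded) (cong best (map-cong option≗moveValue (liveEdges G S)))
  where
  unfolded : ∃ λ option → value G (suc k) S ≡ best (map option (liveEdges G S))
  unfolded = _ , refl
  option≗moveValue : proj₁ unfolded ≗ moveValue G k S
  option≗moveValue e with points G S e
  ... | zero  = refl
  ... | suc p = refl

best-attained : ∀ {M : ℤ} {xs} → All (ℤ._≤ M) xs → M ∈ xs → best xs ≡ M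
best-attained {M} {x ∷ xs} (x≤M ∷ xs≤M) M∈ =
  ℤ.≤-antisym (foldr-preservesᵇ ℤ.⊔-lub x≤M xs≤M) (foldr-preservesᵒ upper x xs (split M∈))
  where
  upper : ∀ a c → M ℤ.≤ a ⊎ M ℤ.≤ c → M ℤ.≤ a ⊔ c
  upper a c (inj₁ M≤a) = ℤ.≤-trans M≤a (ℤ.i≤i⊔j a c)
  upper a c (inj₂ M≤c) = ℤ.≤-trans M≤c (ℤ.i≤j⊔i a c)
  split : M ∈ x ∷ xs → M ℤ.≤ x ⊎ Any (M ℤ.≤_) xs
  split (here M≡x)    = inj₁ (ℤ.≤-reflexive M≡x)
  split (there M∈xs) = inj₂ (Any.map ℤ.≤-reflexive M∈xs)

remove-self : ∀ G S e → remove G S e e ≡ false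
remove-self G S e = cong (λ d → if d then false else S e) (dec-true (e ≟ e) refl)

remove-other : ∀ G S {e f} → f ≢ e → remove G S e f ≡ S f
remove-other G S {e} {f} f≢e = cong (λ d → if d then false else S f) (dec-false (f ≟ e) f≢e)

count-remove : ∀ G S {e} → S e ≡ true → count S ≡ suc (count (remove G S e))
count-remove G S {e} live =
  count-suc-off e (λ f f≢e → sym (remove-other G S f≢e)) live (remove-self G S e)

value-exhausted : ∀ G k {S} → (∀ e → S e ≡ false) → value G k S ≡ + 0
value-exhausted G zero    none = refl
value-exhausted G (suc k) {S} none =
  trans (value-suc G k S) (cong (best ∘ map (moveValue G k S)) (filter-none _ (tabulate⁺ dead)))
  where
  dead : ∀ e → S e ≢ true
  dead e = not-¬ (none e)

lookahead : (G : Graph) → (Position G → ℤ) → Position G → Fin (nE G) → ℤ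
lookahead G Ψ S e = turnValue (points G S e) (Ψ (remove G S e))

record Bellman (G : Graph) (Ψ : Position G → ℤ) : Set where
  field
    exhausted : ∀ S → (∀ e → S e ≡ false) → Ψ S ≡ + 0
    move-≤    : ∀ S e → S e ≡ true → lookahead G Ψ S e ℤ.≤ Ψ S
    optimal   : ∀ S → (∃ λ e → S e ≡ true) →
                ∃ λ e → S e ≡ true × lookahead G Ψ S e ≡ Ψ S

module _ {G : Graph} {Ψ : Position G → ℤ} (bellman : Bellman G Ψ) where
  open Bellman bellman

  value≡solution : ∀ k S → count S ≤ k → value G k S ≡ Ψ S
  value≡solution zero    S S≤0 = sym (exhausted S (count≡0 (ℕ.n≤0⇒n≡0 S≤0)))
  value≡solution (suc k) S S≤k+1 with true-or-none S
  ... | inj₂ none = trans (value-exhausted G (suc k) none) (sym (exhausted S none))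
  ... | inj₁ live = trans (value-suc G k S) (best-attained bounded attained)
    where
    moveValue≡lookahead : ∀ {e} → S e ≡ true → moveValue G k S e ≡ lookahead G Ψ S e
    moveValue≡lookahead {e} Se = cong (turnValue (points G S e))
      (value≡solution k (remove G S e) (ℕ.≤-pred (subst (_≤ suc k) (count-remove G S Se) S≤k+1)))
    bounded : All (ℤ._≤ Ψ S) (map (moveValue G k S) (liveEdges G S))
    bounded = map⁺ (All.tabulate λ {e} e∈ →
      let Se = proj₂ (∈-filter⁻ (λ e → S e Bool.≟ true) {xs = allFin (nE G)} e∈) in
      subst (ℤ._≤ Ψ S) (sym (moveValue≡lookahead Se)) (move-≤ S e Se))
    attained : Ψ S ∈ map (moveValue G k S) (liveEdges G S)
    attained with optimal S live
    ... | e , Se , opt =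
      subst (_∈ _) (trans (moveValue≡lookahead Se) opt)
            (∈-map⁺ (moveValue G k S) (∈-filter⁺ (λ e → S e Bool.≟ true) (∈-allFin e) Se))

  gameValue≡solution : gameValue G ≡ Ψ (λ _ → true)
  gameValue≡solution = value≡solution (nE G) _ (ℕ.≤-reflexive (count-all (nE G)))

-- Values of positions of K(2,n)

star : ℕ → ℕ
star zero    = 0
star (suc x) = suc (suc x)

pureValue : ℕ → ℤ
pureValue zero    = + 3
pureValue (suc f) = - (+ 1 ℤ.+ pureValue f)

-- Φ f x y: f full vertices, x pendant at u, y pendant at v.  A star with
-- x > 0 leaves is worth x + 1 points.  pureValue f is the value of suc f full
-- vertices alone: opening one of them passes the turn and hands the opponent
-- a pendant edge, so pureValue (suc f) = −(1 + pureValue f).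
Φ : ℕ → ℕ → ℕ → ℤ
Φ zero    x y = + (star x + star y)
Φ (suc f) x y = + (x + y) ℤ.+ pureValue f

Φ-cong : ∀ {f f′ x x′ y y′} → f ≡ f′ → x ≡ x′ → y ≡ y′ → Φ f x y ≡ Φ f′ x′ y′
Φ-cong refl refl refl = refl

Φ-comm : ∀ f x y → Φ f x y ≡ Φ f y x
Φ-comm zero    x y = cong +_ (ℕ.+-comm (star x) (star y))
Φ-comm (suc f) x y = cong (λ s → + s ℤ.+ pureValue f) (ℕ.+-comm x y)

pendant-move : ∀ f x y → turnValue (suc [ not (0 <ᵇ f + x) ]) (Φ f x y) ≡ Φ f (suc x) y
pendant-move zero    zero    y = refl
pendant-move zero    (suc x) y = refl
pendant-move (suc f) x       y = sym (ℤ.+-assoc (+ 1) (+ (x + y)) (pureValue f))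

full-move-≤ : ∀ f x y → turnValue [ not (0 <ᵇ f + x) ] (Φ f x (suc y)) ℤ.≤ Φ (suc f) x y
full-move-≤ zero    zero    y = ℤ.≤-reflexive (cong +_ (ℕ.+-comm 3 y))
full-move-≤ zero    (suc x) y = ℤ.neg-≤-pos
full-move-≤ (suc f) x       y = begin
  - (+ (x + suc y) ℤ.+ v)            ≡⟨ cong (λ n → - (+ n ℤ.+ v)) (ℕ.+-suc x y) ⟩
  - (+ 1 ℤ.+ + (x + y) ℤ.+ v)        ≡⟨ regroup (+ (x + y)) v ⟩
  - + (x + y) ℤ.+ - (+ 1 ℤ.+ v)      ≤⟨ ℤ.+-monoˡ-≤ _ (ℤ.neg-≤-pos {x + y}) ⟩
  + (x + y) ℤ.+ pureValue (suc f)    ∎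
  where
  open ℤ.≤-Reasoning
  v : ℤ
  v = pureValue f
  regroup : ∀ a w → - (+ 1 ℤ.+ a ℤ.+ w) ≡ - a ℤ.+ - (+ 1 ℤ.+ w)
  regroup = solve-∀

full-move-pure : ∀ f → turnValue [ not (0 <ᵇ f + 0) ] (Φ f 0 1) ≡ Φ (suc f) 0 0
full-move-pure zero    = refl
full-move-pure (suc f) = sym (ℤ.+-identityˡ _)

pureValue-period : ∀ f → pureValue (suc (suc f)) ≡ pureValue f
pureValue-period f = cancel (pureValue f)
  where
  cancel : ∀ v → - (+ 1 ℤ.+ - (+ 1 ℤ.+ v)) ≡ v
  cancel = solve-∀

pureValue-odd : ∀ f → suc f % 2 ≡ 1 → pureValue f ≡ + 3
pureValue-odd zero          _  = refl
pureValue-odd (suc zero)    ()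
pureValue-odd (suc (suc f)) odd = trans (pureValue-period f) (pureValue-odd f odd)

pureValue-even : ∀ f → suc f % 2 ≡ 0 → pureValue f ≡ -[1+ 3 ]
pureValue-even zero          ()
pureValue-even (suc zero)    _    = refl
pureValue-even (suc (suc f)) even = trans (pureValue-period f) (pureValue-even f even)

-- A i and C i say whether w_i is still joined to u and to v.

both only : ∀ {n} → (Fin n → Bool) → (Fin n → Bool) → ℕ
both A C = count (λ i → A i ∧ C i)
only A C = count (λ i → A i ∧ not (C i))

profileValue : ∀ {n} → (Fin n → Bool) → (Fin n → Bool) → ℤ
profileValue A C = Φ (both A C) (only A C) (only C A)

profileValue-comm : ∀ {n} (A C : Fin n → Bool) → profileValue A C ≡ profileValue C A
profileValue-comm A C = trans (Φ-cong (count-cong λ i → ∧-comm (A i) (C i)) refl refl)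
                              (Φ-comm (both C A) (only A C) (only C A))

-- Removing the edge u w_j turns A, C into A′, C′.
module Removal {n} {A C A′ C′ : Fin n → Bool} {j : Fin n}
  (A′j : A′ j ≡ false) (A′-off : ∀ i → i ≢ j → A′ i ≡ A i) (C′≗C : C′ ≗ C) (Aj : A j ≡ true)
  where

  isolated : Bool
  isolated = not (0 <ᵇ count A′)

  removed-side-lost : (0 <ᵇ count A) ∧ not (0 <ᵇ count A′) ≡ isolated
  removed-side-lost rewrite count-suc-off j (λ i i≢j → sym (A′-off i i≢j)) Aj A′j = refl

  other-side-kept : (0 <ᵇ count C) ∧ not (0 <ᵇ count C′) ≡ false
  other-side-kept rewrite count-cong C′≗C = ∧-inverseʳ (0 <ᵇ count C)

  leaves-lost : count (λ i → (A i ∨ C i) ∧ not (A′ i ∨ C′ i)) ≡ [ not (C j) ]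
  leaves-lost = trans (count-single j off) (cong [_] at)
    where
    off : ∀ i → i ≢ j → (A i ∨ C i) ∧ not (A′ i ∨ C′ i) ≡ false
    off i i≢j rewrite A′-off i i≢j | C′≗C i = ∧-inverseʳ (A i ∨ C i)
    at : (A j ∨ C j) ∧ not (A′ j ∨ C′ j) ≡ not (C j)
    at rewrite Aj | A′j | C′≗C j = refl

  private
    f′ x′ y : ℕ
    f′ = both A′ C′
    x′ = only A′ C′
    y  = only C A

    count-A′ : count A′ ≡ f′ + x′
    count-A′ = count-split A′ C′

    onlyˡ onlyʳ : Bool → Bool → Bool
    onlyˡ a c = a ∧ not c
    onlyʳ a c = c ∧ not a

    unchanged : (g : Bool → Bool → Bool) → ∀ i → i ≢ j → g (A i) (C i) ≡ g (A′ i) (C′ i)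
    unchanged g i i≢j = cong₂ g (sym (A′-off i i≢j)) (sym (C′≗C i))

    module _ {c : Bool} (Cj : C j ≡ c) where
      before : (g : Bool → Bool → Bool) → g (A j) (C j) ≡ g true c
      before g = cong₂ g Aj Cj
      after : (g : Bool → Bool → Bool) → g (A′ j) (C′ j) ≡ g false c
      after g = cong₂ g A′j (trans (C′≗C j) Cj)

    module _ (Cj : C j ≡ true) where
      only-kept : only A C ≡ x′
      only-kept = count-≡-off j (unchanged onlyˡ) (trans (before Cj onlyˡ) (sym (after Cj onlyˡ)))

      full-removal : turnValue [ isolated ] (profileValue A′ C′)
                   ≡ turnValue [ not (0 <ᵇ f′ + x′) ] (Φ f′ x′ (suc y))
      full-removal =
        cong₂ (λ m v → turnValue [ not (0 <ᵇ m) ] v) count-A′ (cong (Φ f′ x′) y-added)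
        where
        y-added : only C′ A′ ≡ suc y
        y-added = count-suc-off j (λ i i≢j → sym (unchanged onlyʳ i i≢j))
                                  (after Cj onlyʳ) (before Cj onlyʳ)

      profileValue-full : profileValue A C ≡ Φ (suc f′) x′ y
      profileValue-full =
        Φ-cong (count-suc-off j (unchanged _∧_) (before Cj _∧_) (after Cj _∧_)) only-kept refl

    pendant-removal : C j ≡ false →
                      turnValue (suc [ isolated ]) (profileValue A′ C′) ≡ profileValue A C
    pendant-removal Cj = begin
      turnValue (suc [ isolated ]) (profileValue A′ C′)
        ≡⟨ cong (λ m → turnValue (suc [ not (0 <ᵇ m) ]) (profileValue A′ C′)) count-A′ ⟩
      turnValue (suc [ not (0 <ᵇ f′ + x′) ]) (Φ f′ x′ (only C′ A′))
        ≡⟨ pendant-move f′ x′ (only C′ A′) ⟩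
      Φ f′ (suc x′) (only C′ A′)
        ≡⟨ Φ-cong both-kept x-removed y-kept ⟨
      profileValue A C
        ∎
      where
      open ≡-Reasoning
      both-kept : both A C ≡ f′
      both-kept = count-≡-off j (unchanged _∧_) (trans (before Cj _∧_) (sym (after Cj _∧_)))
      x-removed : only A C ≡ suc x′
      x-removed = count-suc-off j (unchanged onlyˡ) (before Cj onlyˡ) (after Cj onlyˡ)
      y-kept : y ≡ only C′ A′
      y-kept = count-≡-off j (unchanged onlyʳ) (trans (before Cj onlyʳ) (sym (after Cj onlyʳ)))

  removal-≤ : turnValue ([ not (C j) ] + [ isolated ]) (profileValue A′ C′) ℤ.≤ profileValue A C
  removal-≤ with C j in Cj
  ... | false = ℤ.≤-reflexive (pendant-removal Cj)
  ... | true  = begin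
    turnValue [ isolated ] (profileValue A′ C′)        ≡⟨ full-removal Cj ⟩
    turnValue [ not (0 <ᵇ f′ + x′) ] (Φ f′ x′ (suc y))  ≤⟨ full-move-≤ f′ x′ y ⟩
    Φ (suc f′) x′ y                                   ≡⟨ profileValue-full Cj ⟨
    profileValue A C                                  ∎
    where open ℤ.≤-Reasoning

  removal-pendant : C j ≡ false →
                    turnValue ([ not (C j) ] + [ isolated ]) (profileValue A′ C′) ≡ profileValue A C
  removal-pendant Cj rewrite Cj = pendant-removal Cj

  removal-pure : only A C ≡ 0 → only C A ≡ 0 → C j ≡ true →
                 turnValue ([ not (C j) ] + [ isolated ]) (profileValue A′ C′) ≡ profileValue A C
  removal-pure x≡0 y≡0 Cj rewrite Cj = begin
    turnValue [ isolated ] (profileValue A′ C′)        ≡⟨ full-removal Cj ⟩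
    turnValue [ not (0 <ᵇ f′ + x′) ] (Φ f′ x′ (suc y))
      ≡⟨ cong₂ (λ m k → turnValue [ not (0 <ᵇ f′ + m) ] (Φ f′ m (suc k))) x′≡0 y≡0 ⟩
    turnValue [ not (0 <ᵇ f′ + 0) ] (Φ f′ 0 1)         ≡⟨ full-move-pure f′ ⟩
    Φ (suc f′) 0 0                                    ≡⟨ cong₂ (Φ (suc f′)) x′≡0 y≡0 ⟨
    Φ (suc f′) x′ y                                   ≡⟨ profileValue-full Cj ⟨
    profileValue A C                                  ∎
    where
    open ≡-Reasoning
    x′≡0 : x′ ≡ 0
    x′≡0 = trans (sym (only-kept Cj)) x≡0

ends-combine : ∀ {a b} (i : Fin a) (j : Fin b) → ends (K a b) (combine i j) ≡ (i ↑ˡ b , a ↑ʳ j)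
ends-combine {a} {b} i j = cong (λ ij → proj₁ ij ↑ˡ b , a ↑ʳ proj₂ ij) (remQuot-combine i j)

-- Vertex zero is u, suc zero is v and suc (suc j) is w_j.
module K2 (b : ℕ) where

  G : Graph
  G = K 2 b

  uEdge vEdge : Fin b → Fin (2 * b)
  uEdge = combine {2} zero
  vEdge = combine {2} (suc zero)

  atU atV : Position G → Fin b → Bool
  atU S = S ∘ uEdge
  atV S = S ∘ vEdge

  Ψ : Position G → ℤ
  Ψ S = profileValue (atU S) (atV S)

  data EdgeView : Fin (2 * b) → Set where
    u-edge : ∀ j → EdgeView (uEdge j)
    v-edge : ∀ j → EdgeView (vEdge j)

  edgeView : ∀ e → EdgeView e
  edgeView e = subst EdgeView (combine-remQuot {2} b e) (view (remQuot {2} b e))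
    where
    view : ∀ ij → EdgeView (uncurry combine ij)
    view (zero , j)     = u-edge j
    view (suc zero , j) = v-edge j

  uEdge-injective : ∀ {i j} → uEdge i ≡ uEdge j → i ≡ j
  uEdge-injective {i} {j} = combine-injectiveʳ {m = 2} zero i zero j

  vEdge-injective : ∀ {i j} → vEdge i ≡ vEdge j → i ≡ j
  vEdge-injective {i} {j} = combine-injectiveʳ {m = 2} (suc zero) i (suc zero) j

  uEdge≢vEdge : ∀ i j → uEdge i ≢ vEdge j
  uEdge≢vEdge i j eq with combine-injectiveˡ {m = 2} zero i (suc zero) j eq
  ... | ()

  count-edges : (P : Fin (2 * b) → Bool) → count P ≡ count (P ∘ uEdge) + count (P ∘ vEdge)
  count-edges P = trans (count-↑ b P)
    (cong (_+_ (count (P ∘ uEdge))) (trans (count-↑ b (P ∘ (b ↑ʳ_))) (ℕ.+-identityʳ _)))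

  touches-combine : ∀ i j x →
                    touches G (combine i j) x ≡ does (i ↑ˡ b ≟ x) ∨ does (2 ↑ʳ j ≟ x)
  touches-combine i j x =
    cong (λ uw → does (proj₁ uw ≟ x) ∨ does (proj₂ uw ≟ x)) (ends-combine i j)

  module _ (S : Position G) where

    incidentU incidentV : Fin (nV G) → ℕ
    incidentU x = count (λ j → atU S j ∧ touches G (uEdge j) x)
    incidentV x = count (λ j → atV S j ∧ touches G (vEdge j) x)

    hasEdge-count : ∀ x → hasEdge G S x ≡ (0 <ᵇ incidentU x + incidentV x)
    hasEdge-count x = trans (or-allFin incident) (cong (0 <ᵇ_) (count-edges incident))
      where
      incident : Fin (2 * b) → Bool
      incident e = S e ∧ touches G e x

    hasEdge-u : hasEdge G S zero ≡ (0 <ᵇ count (atU S))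
    hasEdge-u = trans (hasEdge-count zero)
                      (cong (0 <ᵇ_) (trans (cong₂ _+_ at-u at-v) (ℕ.+-identityʳ _)))
      where
      at-u : incidentU zero ≡ count (atU S)
      at-u = count-cong λ j → trans (cong (atU S j ∧_) (touches-combine zero j zero)) (∧-identityʳ _)
      at-v : incidentV zero ≡ 0
      at-v = count-none λ j →
        trans (cong (atV S j ∧_) (touches-combine (suc zero) j zero)) (∧-zeroʳ _)

    hasEdge-v : hasEdge G S (suc zero) ≡ (0 <ᵇ count (atV S))
    hasEdge-v = trans (hasEdge-count (suc zero)) (cong (0 <ᵇ_) (cong₂ _+_ at-u at-v))
      where
      at-u : incidentU (suc zero) ≡ 0
      at-u = count-none λ j →
        trans (cong (atU S j ∧_) (touches-combine zero j (suc zero))) (∧-zeroʳ _)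
      at-v : incidentV (suc zero) ≡ count (atV S)
      at-v = count-cong λ j →
        trans (cong (atV S j ∧_) (touches-combine (suc zero) j (suc zero))) (∧-identityʳ _)

    hasEdge-w : ∀ j → hasEdge G S (suc (suc j)) ≡ atU S j ∨ atV S j
    hasEdge-w j = trans (hasEdge-count (suc (suc j)))
      (trans (cong (0 <ᵇ_) (cong₂ _+_ (at-w zero (atU S)) (at-w (suc zero) (atV S))))
             (0<ᵇ[]+[] (atU S j) (atV S j)))
      where
      leaf-only : ∀ (i : Fin 2) j′ →
                  does (i ↑ˡ b ≟ suc (suc j)) ∨ does (2 ↑ʳ j′ ≟ suc (suc j)) ≡ does (j′ ≟ j)
      leaf-only zero       j′ = refl
      leaf-only (suc zero) j′ = refl
      at-w : ∀ i (P : Fin b → Bool) →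
             count (λ j′ → P j′ ∧ touches G (combine i j′) (suc (suc j))) ≡ [ P j ]
      at-w i P = trans (count-cong λ j′ → cong (P j′ ∧_) (trans (touches-combine i j′ _) (leaf-only i j′)))
                       (count-∧-≟ P j)

  points-split : ∀ S e → let S′ = remove G S e in points G S e ≡
      [ (0 <ᵇ count (atU S)) ∧ not (0 <ᵇ count (atU S′)) ]
    + ([ (0 <ᵇ count (atV S)) ∧ not (0 <ᵇ count (atV S′)) ]
    + count (λ j → (atU S j ∨ atV S j) ∧ not (atU S′ j ∨ atV S′ j)))
  points-split S e = trans (length-filter-tabulate (λ x → hasEdge G S x ∧ not (hasEdge G S′ x)) id)
    (cong₂ _+_ (cong [_] (lost hasEdge-u))
               (cong₂ _+_ (cong [_] (lost hasEdge-v)) (count-cong λ j → lost (λ T → hasEdge-w T j))))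
    where
    S′ : Position G
    S′ = remove G S e
    lost : ∀ {x} {has : Position G → Bool} → (∀ T → hasEdge G T x ≡ has T) →
           hasEdge G S x ∧ not (hasEdge G S′ x) ≡ has S ∧ not (has S′)
    lost eq = cong₂ (λ p q → p ∧ not q) (eq S) (eq S′)

  module UMove (S : Position G) (j : Fin b) (live : atU S j ≡ true) where
    S′ : Position G
    S′ = remove G S (uEdge j)

    open Removal {A = atU S} {atV S} {atU S′} {atV S′} {j}
      (remove-self G S (uEdge j))
      (λ i i≢j → remove-other G S (i≢j ∘ uEdge-injective))
      (λ i → remove-other G S (uEdge≢vEdge j i ∘ sym))
      live public

    lookahead-uEdge : lookahead G Ψ S (uEdge j)
                    ≡ turnValue ([ not (atV S j) ] + [ isolated ]) (profileValue (atU S′) (atV S′))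
    lookahead-uEdge = cong (λ p → turnValue p (Ψ S′)) points-uEdge
      where
      points-uEdge : points G S (uEdge j) ≡ [ not (atV S j) ] + [ isolated ]
      points-uEdge = trans (points-split S (uEdge j))
        (trans (cong₂ _+_ (cong [_] removed-side-lost)
                          (cong₂ _+_ (cong [_] other-side-kept) leaves-lost))
               (ℕ.+-comm [ isolated ] _))

  module VMove (S : Position G) (j : Fin b) (live : atV S j ≡ true) where
    S′ : Position G
    S′ = remove G S (vEdge j)

    open Removal {A = atV S} {atU S} {atV S′} {atU S′} {j}
      (remove-self G S (vEdge j))
      (λ i i≢j → remove-other G S (i≢j ∘ vEdge-injective))
      (λ i → remove-other G S (uEdge≢vEdge i j))
      live public

    lookahead-vEdge : lookahead G Ψ S (vEdge j)
                    ≡ turnValue ([ not (atU S j) ] + [ isolated ]) (profileValue (atV S′) (atU S′))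
    lookahead-vEdge = cong₂ turnValue points-vEdge (profileValue-comm (atU S′) (atV S′))
      where
      leaves-lost′ : count (λ i → (atU S i ∨ atV S i) ∧ not (atU S′ i ∨ atV S′ i))
                   ≡ [ not (atU S j) ]
      leaves-lost′ = trans (count-cong λ i → cong₂ (λ p q → p ∧ not q) (∨-comm (atU S i) (atV S i))
                                                                         (∨-comm (atU S′ i) (atV S′ i)))
                           leaves-lost
      points-vEdge : points G S (vEdge j) ≡ [ not (atU S j) ] + [ isolated ]
      points-vEdge = trans (points-split S (vEdge j))
        (trans (cong₂ _+_ (cong [_] other-side-kept)
                          (cong₂ _+_ (cong [_] removed-side-lost) leaves-lost′))
               (ℕ.+-comm [ isolated ] _))

  OptimalMove : Position G → Set
  OptimalMove S = ∃ λ e → S e ≡ true × lookahead G Ψ S e ≡ Ψ S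

  pendant-at-u : ∀ S j → atU S j ∧ not (atV S j) ≡ true → OptimalMove S
  pendant-at-u S j pendant with ∧-not-true (atU S j) (atV S j) pendant
  ... | Aj , Cj = uEdge j , Aj , trans lookahead-uEdge (removal-pendant Cj)
    where open UMove S j Aj

  pendant-at-v : ∀ S j → atV S j ∧ not (atU S j) ≡ true → OptimalMove S
  pendant-at-v S j pendant with ∧-not-true (atV S j) (atU S j) pendant
  ... | Cj , Aj = vEdge j , Cj ,
      trans lookahead-vEdge (trans (removal-pendant Aj) (profileValue-comm (atV S) (atU S)))
    where open VMove S j Cj

  full-at-u : ∀ S j → only (atU S) (atV S) ≡ 0 → only (atV S) (atU S) ≡ 0 →
              atU S j ≡ true → atV S j ≡ true → OptimalMove S
  full-at-u S j x≡0 y≡0 Aj Cj = uEdge j , Aj , trans lookahead-uEdge (removal-pure x≡0 y≡0 Cj)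
    where open UMove S j Aj

  bellman : Bellman G Ψ
  bellman = record { exhausted = exhausted ; move-≤ = move-≤ ; optimal = optimal }
    where
    exhausted : ∀ S → (∀ e → S e ≡ false) → Ψ S ≡ + 0
    exhausted S none = Φ-cong
      (count-none λ j → cong (λ a → a ∧ atV S j) (none (uEdge j)))
      (count-none λ j → cong (λ a → a ∧ not (atV S j)) (none (uEdge j)))
      (count-none λ j → cong (λ c → c ∧ not (atU S j)) (none (vEdge j)))

    move-≤ : ∀ S e → S e ≡ true → lookahead G Ψ S e ℤ.≤ Ψ S
    move-≤ S e live with edgeView e
    ... | u-edge j = subst (ℤ._≤ Ψ S) (sym lookahead-uEdge) removal-≤
      where open UMove S j live
    ... | v-edge j = subst₂ ℤ._≤_ (sym lookahead-vEdge) (profileValue-comm (atV S) (atU S)) removal-≤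
      where open VMove S j live

    -- Pendant edges are always worth taking; without them every move is as good as any other.
    optimal : ∀ S → (∃ λ e → S e ≡ true) → OptimalMove S
    optimal S (e , live) with true-or-none (λ j → atU S j ∧ not (atV S j))
                            | true-or-none (λ j → atV S j ∧ not (atU S j))
    ... | inj₁ (j , pendant) | _                  = pendant-at-u S j pendant
    ... | inj₂ _             | inj₁ (j , pendant) = pendant-at-v S j pendant
    ... | inj₂ noU           | inj₂ noV           = full (edgeView e) live
      where
      full : ∀ {e} → EdgeView e → S e ≡ true → OptimalMove S
      full (u-edge j) Aj = full-at-u S j (count-none noU) (count-none noV) Aj (∧-not-false _ Aj (noU j))
      full (v-edge j) Cj = full-at-u S j (count-none noU) (count-none noV) (∧-not-false _ Cj (noV j)) Cj

  Ψ-initial : Ψ (λ _ → true) ≡ Φ b 0 0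
  Ψ-initial = Φ-cong (count-all b) none none
    where
    none : count {b} (λ _ → false) ≡ 0
    none = count-none {b} λ _ → refl

gameValue-K2 : ∀ f → gameValue (K 2 (suc f)) ≡ pureValue f
gameValue-K2 f = begin
  gameValue (K 2 (suc f))   ≡⟨ gameValue≡solution bellman ⟩
  Ψ (λ _ → true)            ≡⟨ Ψ-initial ⟩
  + 0 ℤ.+ pureValue f       ≡⟨ ℤ.+-identityˡ (pureValue f) ⟩
  pureValue f               ∎
  where
  open K2 (suc f)
  open ≡-Reasoning

theorem6 : (b : ℕ) → 1 ≤ b →
    (b % 2 ≡ 1 → + 0 < gameValue (K 2 b)) × (b % 2 ≡ 0 → gameValue (K 2 b) < + 0)
theorem6 (suc f) _ rewrite gameValue-K2 f =
    (λ odd  → subst (+ 0 <_) (sym (pureValue-odd f odd)) (+<+ (s≤s z≤n)))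
  , (λ even → subst (_< + 0) (sym (pureValue-even f even)) -<+)
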